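{- A sticky tree is determined by its underlying plane tree together with its certificate-counting function: if two sticky trees $(S,\ell)$ and $(S,\ell')$ on the same plane tree $S$ have the same certificate-counting function, then $\ell=\ell'$. Hence the map sending a sticky tree to the pair (underlying plane tree, certificate-counting function) is a bijection onto its image.
   Context: Plane trees, prefix order (root, then children's subtrees left to right), depth (root depth $0$), $S_w$ = subtree rooted at $w$. A sticky tree is a plane tree with $\ell:V\to\mathbb{N}$ such that (1) $0\le\ell(w)\le$ depth$(w)$; (2) every node $w$ of depth $d>0$ has some $z\in S_w$ (possibly $w$) with $\ell(z)<d$; (3) for every node $w$ of depth $d$, if some $z\in S_w$ has $\ell(z)=d$, then every node of $S_w$ (including $w$) preceding $z$ in prefix order has label $\ge d$. The certificate of a non-root node $w$ of depth $d$ is the first node of $S_w$ in prefix order with label $<d$. The certificate-counting function $c$ maps each node $w$ to the number of nodes whose certificate is $w$. -}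

module Defs where

open import Data.Nat using (ℕ; zero; suc; _≤_; _<_; _<ᵇ_)
open import Data.List using (List; []; _∷_; _++_; length; map; findᵇ; filterᵇ)
open import Data.Maybe using (Maybe; just; nothing; maybe)
open import Data.Bool using (Bool; true; false)
open import Data.Product using (Σ; _×_; ∃)
open import Relation.Binary.PropositionalEquality using (_≡_; refl)

data Tree : Set where
  node : List Tree → Tree

-- Nodes of a plane tree t (Node t), and nodes of a forest ts (CNode ts),
-- given by their path from the root:
--   here   = the root of t,
--   down c = the node c inside the forest of children of the root,
--   hd p   = node p inside the first tree of the forest,
--   tl c   = node c inside the remaining trees of the forest.
data Node : Tree → Set
data CNode : List Tree → Set

data Node where
  here : ∀ {ts} → Node (node ts)
  down : ∀ {ts} → CNode ts → Node (node ts)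

data CNode where
  hd : ∀ {t ts} → Node t → CNode (t ∷ ts)
  tl : ∀ {t ts} → CNode ts → CNode (t ∷ ts)

depth  : ∀ {t} → Node t → ℕ
cdepth : ∀ {ts} → CNode ts → ℕ
depth here     = zero
depth (down c) = suc (cdepth c)
cdepth (hd p) = depth p
cdepth (tl c) = cdepth c

-- w ≼ z  iff  z ∈ S_w  (z is w or a descendant of w)
data _≼_ : ∀ {t} → Node t → Node t → Set
data _≼c_ : ∀ {ts} → CNode ts → CNode ts → Set

data _≼_ where
  here≼ : ∀ {ts} {z : Node (node ts)} → here ≼ z
  down≼ : ∀ {ts} {c d : CNode ts} → c ≼c d → down c ≼ down d

data _≼c_ where
  hd≼ : ∀ {t ts} {p q : Node t} → p ≼ q → hd {ts = ts} p ≼c hd q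
  tl≼ : ∀ {t ts} {c d : CNode ts} → c ≼c d → tl {t = t} c ≼c tl d

-- y ≺ z  iff  y strictly precedes z in prefix order
-- (root first, then the children's subtrees from left to right)
data _≺_ : ∀ {t} → Node t → Node t → Set
data _≺c_ : ∀ {ts} → CNode ts → CNode ts → Set

data _≺_ where
  here≺ : ∀ {ts} {c : CNode ts} → here ≺ down c
  down≺ : ∀ {ts} {c d : CNode ts} → c ≺c d → down c ≺ down d

data _≺c_ where
  hd≺hd : ∀ {t ts} {p q : Node t} → p ≺ q → hd {ts = ts} p ≺c hd q
  hd≺tl : ∀ {t ts} {p : Node t} {d : CNode ts} → hd p ≺c tl d
  tl≺tl : ∀ {t ts} {c d : CNode ts} → c ≺c d → tl {t = t} c ≺c tl d

record Sticky (S : Tree) (ℓ : Node S → ℕ) : Set where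
  field
    cond1 : ∀ w → ℓ w ≤ depth w
    cond2 : ∀ w → 0 < depth w → ∃ λ z → w ≼ z × ℓ z < depth w
    cond3 : ∀ w z → w ≼ z → ℓ z ≡ depth w →
            ∀ y → w ≼ y → y ≺ z → depth w ≤ ℓ y

allNodes  : (t : Tree) → List (Node t)
allCNodes : (ts : List Tree) → List (CNode ts)
allNodes (node ts) = here ∷ map down (allCNodes ts)
allCNodes []       = []
allCNodes (t ∷ ts) = map hd (allNodes t) ++ map tl (allCNodes ts)

sub  : ∀ {t} → Node t → Tree
csub : ∀ {ts} → CNode ts → Tree
sub {t} here = t
sub (down c) = csub c
csub (hd p) = sub p
csub (tl c) = csub c

embed  : ∀ {t} (w : Node t) → Node (sub w) → Node t
cembed : ∀ {ts} (c : CNode ts) → Node (csub c) → CNode ts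
embed here     z = z
embed (down c) z = down (cembed c z)
cembed (hd p) z = hd (embed p z)
cembed (tl c) z = tl (cembed c z)

nodesUnder : ∀ {t} → Node t → List (Node t)
nodesUnder w = map (embed w) (allNodes (sub w))

eqNode  : ∀ {t} → Node t → Node t → Bool
eqCNode : ∀ {ts} → CNode ts → CNode ts → Bool
eqNode here     here     = true
eqNode (down c) (down d) = eqCNode c d
eqNode _        _        = false
eqCNode (hd p) (hd q) = eqNode p q
eqCNode (tl c) (tl d) = eqCNode c d
eqCNode _      _      = false

certificate : ∀ {t} → (Node t → ℕ) → Node t → Maybe (Node t)
certificate ℓ here = nothing
certificate ℓ w@(down _) = findᵇ (λ z → ℓ z <ᵇ depth w) (nodesUnder w)

certCount : (t : Tree) → (Node t → ℕ) → Node t → ℕ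
certCount t ℓ z = length (filterᵇ (λ w → maybe (eqNode z) false (certificate ℓ w)) (allNodes t))

-- Suppose ℓ ≠ ℓ′ and let z be the first node in prefix order where they differ,
-- say ℓ z < ℓ′ z.  Every node certified by z under ℓ′ is still certified by z
-- under ℓ, since the two labellings agree before z and z only got smaller.  But
-- the ancestor w of z at depth ℓ′ z, which exists by condition (1), is certified
-- by z under ℓ (condition (3) for ℓ′ makes z the first node of S_w below depth w)
-- and not under ℓ′.  Hence z is counted strictly more often under ℓ than under ℓ′.
module Submission where

open import Defs
open import Data.Nat using (ℕ; zero; suc; _+_; _≤_; _<_; _<ᵇ_; z≤n; s≤s; s<s)
open import Data.Nat.Properties
  using (<ᵇ⇒<; <⇒<ᵇ; ≮⇒≥; <⇒≱; n≮0; m≤n⇒m≤1+n; <-≤-trans; m≤m+n;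
         +-monoʳ-<; <-trans; <-cmp; <⇒≢; >⇒≢)
open import Data.Nat.Induction using (<-wellFounded)
open import Data.List using (List; []; _∷_; length; map; findᵇ; filterᵇ)
open import Data.List.Relation.Unary.All as All using (All)
import Data.List.Relation.Unary.All.Properties as All
open import Data.List.Relation.Unary.Any using (here; there)
open import Data.List.Relation.Unary.AllPairs as AllPairs using (AllPairs; []; _∷_)
import Data.List.Relation.Unary.AllPairs.Properties as AllPairs
open import Data.List.Membership.Propositional using (_∈_)
open import Data.List.Membership.Propositional.Properties using (∈-map⁺; ∈-map⁻; ∈-++⁺ˡ; ∈-++⁺ʳ)
open import Data.Maybe using (Maybe; just; maybe)
open import Data.Bool using (Bool; true; false; T)
open import Data.Bool.Properties using (T-≡)
open import Data.Unit using (tt)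
open import Data.Empty using (⊥-elim)
open import Data.Product using (∃; _×_; _,_)
open import Function using (_∘_; _⇔_; mk⇔; Equivalence)
open import Induction.WellFounded using (WellFounded; wf⇒asym)
import Induction.WellFounded as WF
open import Relation.Binary using (Rel; Asymmetric; tri<; tri≈; tri>)
import Relation.Binary.Construct.On as On
open import Relation.Binary.PropositionalEquality using (_≡_; _≢_; refl; sym; cong; subst)
open import Relation.Nullary using (¬_; contradiction)

open Equivalence using (to; from)

T-true : ∀ {b} → b ≡ true → T b
T-true = from T-≡

¬T-false : ∀ {b} → b ≡ false → ¬ T b
¬T-false refl ()

module _ {A : Set} where

  module _ {r} {R : Rel A r} (R-asym : Asymmetric R) (p : A → Bool) where

    findᵇ-sorted⇒ : ∀ {xs z} → AllPairs R xs → findᵇ p xs ≡ just z →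
                    z ∈ xs × T (p z) × (∀ {y} → y ∈ xs → R y z → ¬ T (p y))
    findᵇ-sorted⇒ {x ∷ xs} (x<xs ∷ sorted) eq with p x in px
    findᵇ-sorted⇒ {x ∷ xs} (x<xs ∷ sorted) refl | true =
      here refl , T-true px , λ where
        (here refl) y<x → λ _ → R-asym y<x y<x
        (there y∈)  y<x → λ _ → R-asym (All.lookup x<xs y∈) y<x
    ... | false with z∈ , pz , first ← findᵇ-sorted⇒ sorted eq =
      there z∈ , pz , λ where
        (here refl) _ → ¬T-false px
        (there y∈)  → first y∈

    findᵇ-sorted⇐ : ∀ {xs z} → AllPairs R xs → z ∈ xs → T (p z) →
                    (∀ {y} → y ∈ xs → R y z → ¬ T (p y)) → findᵇ p xs ≡ just z
    findᵇ-sorted⇐ {x ∷ xs} (x<xs ∷ sorted) z∈ pz first with p x in px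
    findᵇ-sorted⇐ (x<xs ∷ sorted) (here refl) pz first | true = refl
    findᵇ-sorted⇐ (x<xs ∷ sorted) (there z∈) pz first | true =
      contradiction (T-true px) (first (here refl) (All.lookup x<xs z∈))
    findᵇ-sorted⇐ (x<xs ∷ sorted) (here refl) pz first | false = contradiction pz (¬T-false px)
    findᵇ-sorted⇐ (x<xs ∷ sorted) (there z∈) pz first | false =
      findᵇ-sorted⇐ sorted z∈ pz (first ∘ there)

  module _ (p q : A → Bool) (q⇒p : ∀ x → T (q x) → T (p x)) where

    length-filterᵇ-mono : ∀ xs → length (filterᵇ q xs) ≤ length (filterᵇ p xs)
    length-filterᵇ-mono [] = z≤n
    length-filterᵇ-mono (x ∷ xs) with q x in qx | p x in px
    ... | true  | true  = s≤s (length-filterᵇ-mono xs)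
    ... | true  | false = contradiction (q⇒p x (T-true qx)) (¬T-false px)
    ... | false | true  = m≤n⇒m≤1+n (length-filterᵇ-mono xs)
    ... | false | false = length-filterᵇ-mono xs

    length-filterᵇ-< : ∀ {xs x₀} → x₀ ∈ xs → T (p x₀) → ¬ T (q x₀) →
                       length (filterᵇ q xs) < length (filterᵇ p xs)
    length-filterᵇ-< {x ∷ xs} (there x₀∈) px₀ ¬qx₀ with q x in qx | p x in px
    ... | true  | true  = s<s (length-filterᵇ-< x₀∈ px₀ ¬qx₀)
    ... | true  | false = contradiction (q⇒p x (T-true qx)) (¬T-false px)
    ... | false | true  = m≤n⇒m≤1+n (length-filterᵇ-< x₀∈ px₀ ¬qx₀)
    ... | false | false = length-filterᵇ-< x₀∈ px₀ ¬qx₀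
    length-filterᵇ-< {x ∷ xs} (here refl) px₀ ¬qx₀ with q x in qx | p x in px
    ... | true  | _     = contradiction tt ¬qx₀
    ... | false | false = ⊥-elim px₀
    ... | false | true  = s≤s (length-filterᵇ-mono xs)

size  : Tree → ℕ
csize : List Tree → ℕ
size (node ts) = suc (csize ts)
csize []       = 0
csize (t ∷ ts) = size t + csize ts

position  : ∀ {t} → Node t → ℕ
cposition : ∀ {ts} → CNode ts → ℕ
position here     = 0
position (down c) = suc (cposition c)
cposition (hd p)         = position p
cposition (tl {t = t} c) = size t + cposition c

position<size   : ∀ {t} (p : Node t) → position p < size t
cposition<csize : ∀ {ts} (c : CNode ts) → cposition c < csize ts
position<size here     = s≤s z≤n
position<size (down c) = s<s (cposition<csize c)
cposition<csize {t ∷ ts} (hd p) = <-≤-trans (position<size p) (m≤m+n (size t) (csize ts))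
cposition<csize {t ∷ ts} (tl c) = +-monoʳ-< (size t) (cposition<csize c)

position-mono-≺  : ∀ {t} {p q : Node t} → p ≺ q → position p < position q
cposition-mono-≺ : ∀ {ts} {c d : CNode ts} → c ≺c d → cposition c < cposition d
position-mono-≺ here≺     = s≤s z≤n
position-mono-≺ (down≺ r) = s<s (cposition-mono-≺ r)
cposition-mono-≺ (hd≺hd r) = position-mono-≺ r
cposition-mono-≺ {t ∷ ts} (hd≺tl {p = p} {d = d}) =
  <-≤-trans (position<size p) (m≤m+n (size t) (cposition d))
cposition-mono-≺ {t ∷ ts} (tl≺tl r) = +-monoʳ-< (size t) (cposition-mono-≺ r)

≺-wellFounded : ∀ {t} → WellFounded (_≺_ {t})
≺-wellFounded = WF.Subrelation.wellFounded position-mono-≺ (On.wellFounded position <-wellFounded)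

≺-asym : ∀ {t} → Asymmetric (_≺_ {t})
≺-asym = wf⇒asym ≺-wellFounded

allNodes-sorted  : ∀ t → AllPairs _≺_ (allNodes t)
allCNodes-sorted : ∀ ts → AllPairs _≺c_ (allCNodes ts)
allNodes-sorted (node ts) =
  All.map⁺ (All.universal (λ _ → here≺) (allCNodes ts))
  ∷ AllPairs.map⁺ (AllPairs.map down≺ (allCNodes-sorted ts))
allCNodes-sorted []       = []
allCNodes-sorted (t ∷ ts) =
  AllPairs.++⁺ (AllPairs.map⁺ (AllPairs.map hd≺hd (allNodes-sorted t)))
               (AllPairs.map⁺ (AllPairs.map tl≺tl (allCNodes-sorted ts)))
               (All.map⁺ (All.universal (λ _ → All.map⁺ (All.universal (λ _ → hd≺tl) (allCNodes ts)))
                                        (allNodes t)))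

∈-allNodes  : ∀ {t} (z : Node t) → z ∈ allNodes t
∈-allCNodes : ∀ {ts} (c : CNode ts) → c ∈ allCNodes ts
∈-allNodes here     = here refl
∈-allNodes (down c) = there (∈-map⁺ down (∈-allCNodes c))
∈-allCNodes          (hd p) = ∈-++⁺ˡ (∈-map⁺ hd (∈-allNodes p))
∈-allCNodes {t ∷ ts} (tl c) = ∈-++⁺ʳ (map hd (allNodes t)) (∈-map⁺ tl (∈-allCNodes c))

embed-mono-≺  : ∀ {t} (w : Node t) {p q} → p ≺ q → embed w p ≺ embed w q
cembed-mono-≺ : ∀ {ts} (c : CNode ts) {p q} → p ≺ q → cembed c p ≺c cembed c q
embed-mono-≺ here     r = r
embed-mono-≺ (down c) r = down≺ (cembed-mono-≺ c r)
cembed-mono-≺ (hd p) r = hd≺hd (embed-mono-≺ p r)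
cembed-mono-≺ (tl c) r = tl≺tl (cembed-mono-≺ c r)

≼-embed  : ∀ {t} (w : Node t) p → w ≼ embed w p
≼c-cembed : ∀ {ts} (c : CNode ts) p → c ≼c cembed c p
≼-embed here     p = here≼
≼-embed (down c) p = down≼ (≼c-cembed c p)
≼c-cembed (hd q) p = hd≼ (≼-embed q p)
≼c-cembed (tl c) p = tl≼ (≼c-cembed c p)

≼⇒∃-embed  : ∀ {t} {w z : Node t} → w ≼ z → ∃ λ p → embed w p ≡ z
≼c⇒∃-cembed : ∀ {ts} {c d : CNode ts} → c ≼c d → ∃ λ p → cembed c p ≡ d
≼⇒∃-embed {z = z} here≼ = z , refl
≼⇒∃-embed (down≼ r) with p , refl ← ≼c⇒∃-cembed r = p , refl
≼c⇒∃-cembed (hd≼ r) with p , refl ← ≼⇒∃-embed r = p , refl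
≼c⇒∃-cembed (tl≼ r) with p , refl ← ≼c⇒∃-cembed r = p , refl

nodesUnder-sorted : ∀ {t} (w : Node t) → AllPairs _≺_ (nodesUnder w)
nodesUnder-sorted w = AllPairs.map⁺ (AllPairs.map (embed-mono-≺ w) (allNodes-sorted (sub w)))

∈-nodesUnder⁺ : ∀ {t} {w z : Node t} → w ≼ z → z ∈ nodesUnder w
∈-nodesUnder⁺ {w = w} w≼z with p , refl ← ≼⇒∃-embed w≼z = ∈-map⁺ (embed w) (∈-allNodes p)

∈-nodesUnder⁻ : ∀ {t} {w z : Node t} → z ∈ nodesUnder w → w ≼ z
∈-nodesUnder⁻ {w = w} z∈ with p , _ , refl ← ∈-map⁻ (embed w) z∈ = ≼-embed w p

ancestor-at-depth  : ∀ {t} (z : Node t) {k} → k ≤ depth z → ∃ λ w → w ≼ z × depth w ≡ k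
cancestor-at-depth : ∀ {ts} (c : CNode ts) {k} → k ≤ cdepth c → ∃ λ d → d ≼c c × cdepth d ≡ k
ancestor-at-depth here     {zero} _ = here , here≼ , refl
ancestor-at-depth (down _) {zero} _ = here , here≼ , refl
ancestor-at-depth (down c) {suc k} (s≤s k≤d) with d , d≼c , refl ← cancestor-at-depth c k≤d =
  down d , down≼ d≼c , refl
cancestor-at-depth (hd p) k≤d with w , w≼p , dw ← ancestor-at-depth p k≤d = hd w , hd≼ w≼p , dw
cancestor-at-depth (tl c) k≤d with d , d≼c , dd ← cancestor-at-depth c k≤d = tl d , tl≼ d≼c , dd

eqNode-refl  : ∀ {t} (z : Node t) → T (eqNode z z)
eqCNode-refl : ∀ {ts} (c : CNode ts) → T (eqCNode c c)
eqNode-refl here     = tt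
eqNode-refl (down c) = eqCNode-refl c
eqCNode-refl (hd p) = eqNode-refl p
eqCNode-refl (tl c) = eqCNode-refl c

eqNode-sound  : ∀ {t} {z z′ : Node t} → T (eqNode z z′) → z ≡ z′
eqCNode-sound : ∀ {ts} {c d : CNode ts} → T (eqCNode c d) → c ≡ d
eqNode-sound {z = here}   {here}   _ = refl
eqNode-sound {z = down c} {down d} e = cong down (eqCNode-sound e)
eqCNode-sound {c = hd p} {hd q} e = cong hd (eqNode-sound e)
eqCNode-sound {c = tl c} {tl d} e = cong tl (eqCNode-sound e)

record IsCertificate {t} (ℓ : Node t → ℕ) (w z : Node t) : Set where
  field
    inside : w ≼ z
    below  : ℓ z < depth w
    first  : ∀ y → w ≼ y → y ≺ z → depth w ≤ ℓ y

certificate≡just⇔IsCertificate : ∀ {t} (ℓ : Node t → ℕ) (w z : Node t) →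
                                 certificate ℓ w ≡ just z ⇔ IsCertificate ℓ w z
certificate≡just⇔IsCertificate ℓ here z = mk⇔ (λ ()) (λ c → contradiction (IsCertificate.below c) n≮0)
certificate≡just⇔IsCertificate ℓ w@(down _) z = mk⇔ sound complete
  where
  below? = λ y → ℓ y <ᵇ depth w

  sound : certificate ℓ w ≡ just z → IsCertificate ℓ w z
  sound eq with z∈ , ℓz<d , earlier ← findᵇ-sorted⇒ ≺-asym below? (nodesUnder-sorted w) eq =
    record { inside = ∈-nodesUnder⁻ z∈
           ; below  = <ᵇ⇒< _ _ ℓz<d
           ; first  = λ y w≼y y≺z → ≮⇒≥ (earlier (∈-nodesUnder⁺ w≼y) y≺z ∘ <⇒<ᵇ) }

  complete : IsCertificate ℓ w z → certificate ℓ w ≡ just z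
  complete c = findᵇ-sorted⇐ ≺-asym below? (nodesUnder-sorted w)
    (∈-nodesUnder⁺ inside) (<⇒<ᵇ below)
    (λ y∈ y≺z ℓy<d → <⇒≱ (<ᵇ⇒< _ _ ℓy<d) (first _ (∈-nodesUnder⁻ y∈) y≺z))
    where open IsCertificate c

certifies⇔ : ∀ {t} {z : Node t} (m : Maybe (Node t)) → T (maybe (eqNode z) false m) ⇔ m ≡ just z
certifies⇔ {z = z} m = mk⇔ (sound m) complete
  where
  sound : ∀ m → T (maybe (eqNode z) false m) → m ≡ just z
  sound (just z′) e = cong just (sym (eqNode-sound e))

  complete : m ≡ just z → T (maybe (eqNode z) false m)
  complete refl = eqNode-refl z

certCount-< : ∀ S (ℓ ℓ′ : Node S → ℕ) {z w₀} →
              (∀ w → certificate ℓ′ w ≡ just z → certificate ℓ w ≡ just z) →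
              certificate ℓ w₀ ≡ just z → certificate ℓ′ w₀ ≢ just z →
              certCount S ℓ′ z < certCount S ℓ z
certCount-< S ℓ ℓ′ {z} {w₀} ℓ′⇒ℓ cert cert′ =
  length-filterᵇ-< (certifies ℓ) (certifies ℓ′)
    (λ w → from (certifies⇔ (certificate ℓ w)) ∘ ℓ′⇒ℓ w ∘ to (certifies⇔ (certificate ℓ′ w)))
    (∈-allNodes w₀) (from (certifies⇔ (certificate ℓ w₀)) cert)
    (cert′ ∘ to (certifies⇔ (certificate ℓ′ w₀)))
  where
  certifies : (Node S → ℕ) → Node S → Bool
  certifies λ₀ w = maybe (eqNode z) false (certificate λ₀ w)

module FirstDisagreement {S : Tree} {ℓ ℓ′ : Node S → ℕ} {z : Node S}
                         (agree : ∀ {y} → y ≺ z → ℓ y ≡ ℓ′ y) (smaller : ℓ z < ℓ′ z) where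

  ≤ℓ′⇒≤ℓ : ∀ {y n} → y ≺ z → n ≤ ℓ′ y → n ≤ ℓ y
  ≤ℓ′⇒≤ℓ y≺z = subst (_ ≤_) (sym (agree y≺z))

  IsCertificate-lower : ∀ {w} → IsCertificate ℓ′ w z → IsCertificate ℓ w z
  IsCertificate-lower c = record
    { inside = inside
    ; below  = <-trans smaller below
    ; first  = λ y w≼y y≺z → ≤ℓ′⇒≤ℓ y≺z (first y w≼y y≺z)
    }
    where open IsCertificate c

  newly-certified : Sticky S ℓ′ → ∃ λ w → IsCertificate ℓ w z × ¬ IsCertificate ℓ′ w z
  newly-certified sticky with w , w≼z , dw ← ancestor-at-depth z (Sticky.cond1 sticky z) =
    w , certified , λ c → <⇒≢ (IsCertificate.below c) (sym dw)
    where
    certified : IsCertificate ℓ w z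
    certified = record
      { inside = w≼z
      ; below  = subst (ℓ z <_) (sym dw) smaller
      ; first  = λ y w≼y y≺z → ≤ℓ′⇒≤ℓ y≺z (Sticky.cond3 sticky w z w≼z (sym dw) y w≼y y≺z)
      }

  certCount-decreases : Sticky S ℓ′ → certCount S ℓ′ z < certCount S ℓ z
  certCount-decreases sticky with w , certified , ¬certified′ ← newly-certified sticky =
    certCount-< S ℓ ℓ′ {z} {w}
      (λ v → from (certificate≡just⇔IsCertificate ℓ v z) ∘ IsCertificate-lower
             ∘ to (certificate≡just⇔IsCertificate ℓ′ v z))
      (from (certificate≡just⇔IsCertificate ℓ w z) certified)
      (¬certified′ ∘ to (certificate≡just⇔IsCertificate ℓ′ w z))

corollary4p6 : (S : Tree) (ℓ ℓ′ : Node S → ℕ) →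
               Sticky S ℓ → Sticky S ℓ′ →
               (∀ z → certCount S ℓ z ≡ certCount S ℓ′ z) →
               ∀ w → ℓ w ≡ ℓ′ w
corollary4p6 S ℓ ℓ′ sticky sticky′ same-count = WF.All.wfRec ≺-wellFounded _ (λ z → ℓ z ≡ ℓ′ z) step
  where
  step : ∀ z → (∀ {y} → y ≺ z → ℓ y ≡ ℓ′ y) → ℓ z ≡ ℓ′ z
  step z agree with <-cmp (ℓ z) (ℓ′ z)
  ... | tri≈ _ eq _ = eq
  ... | tri< lt _ _ =
    contradiction (same-count z) (>⇒≢ (FirstDisagreement.certCount-decreases agree lt sticky′))
  ... | tri> _ _ gt =
    contradiction (same-count z) (<⇒≢ (FirstDisagreement.certCount-decreases (sym ∘ agree) gt sticky))
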